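{- Let $q=p^m$ be a power of a prime $p$, and let $n,r$ be positive integers such that $d:=(nm,r)=(m,r)$, $p\nmid n$, and $(n,p^d-1)=1$. Then for each $c\in\mathbb{F}_q$, the polynomial $L_{c,r}(x):=x^{p^r}-cx$ induces a permutation of $\ker(T_{q^n|q})$.
   Context: $T_{q^n|q}(x)=\sum_{i=0}^{n-1}x^{q^i}$ is the trace map from $\mathbb{F}_{q^n}$ to $\mathbb{F}_q$, and $\ker(T_{q^n|q})\subseteq\mathbb{F}_{q^n}$ is its kernel. -}

module Defs where

open import Level using (0ℓ)
open import Data.Nat using (ℕ; zero; suc)
open import Data.Fin using (Fin)
open import Data.Product using (Σ; _×_)
open import Relation.Nullary using (¬_)
open import Relation.Binary.PropositionalEquality using () renaming (setoid to ≡-setoid)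
open import Function.Bundles using (Inverse)
open import Algebra.Bundles using (CommutativeRing)

module FF (R : CommutativeRing 0ℓ 0ℓ) where
  open CommutativeRing R

  infixr 8 _^_
  _^_ : Carrier → ℕ → Carrier
  x ^ zero = 1#
  x ^ suc k = x * (x ^ k)

  IsField : Set
  IsField = (¬ (1# ≈ 0#)) × (∀ x → ¬ (x ≈ 0#) → Σ Carrier λ y → x * y ≈ 1#)

  HasCard : ℕ → Set
  HasCard N = Inverse setoid (≡-setoid (Fin N))

  trace : (q n : ℕ) → Carrier → Carrier
  trace q zero x = 0#
  trace q (suc i) x = trace q i x + x ^ (q Data.Nat.^ i)

  InKer : (q n : ℕ) → Carrier → Set
  InKer q n x = trace q n x ≈ 0#

  L : (p r : ℕ) → Carrier → Carrier → Carrier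
  L p r c x = x ^ (p Data.Nat.^ r) - c * x

  PermutesOn : (Carrier → Set) → (Carrier → Carrier) → Set
  PermutesOn S f =
    (∀ x → S x → S (f x)) ×
    (∀ x y → S x → S y → f x ≈ f y → x ≈ y) ×
    (∀ y → S y → Σ Carrier λ x → S x × f x ≈ y)

{-# OPTIONS --safe #-}
-- Let q = p ^ m, T the trace and d = gcd(m, r). Suppose 0 ≠ z ∈ ker T with z ^ (p ^ r) = c z.
-- The exponents s with z ^ (p ^ s) = a z for some a ∈ F_q contain r, are closed under addition
-- and are periodic modulo nm (every element of F_{q^n} satisfies x ^ (p ^ nm) = x), so they
-- contain gcd(nm, r) = d and hence m: z ^ q = g z with g ∈ F_q. Raising z ^ q to the power p ^ d
-- in two ways gives g ^ (p ^ d - 1) = 1, and z ^ (q ^ n) = z gives g ^ n = 1; as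
-- gcd(n, p ^ d - 1) = 1, g = 1. Then T z = n z = 0 forces p ∣ n, a contradiction. Hence the
-- additive map L, which commutes with T, is injective on ker T, and finiteness makes it a
-- permutation.

module Submission where

open import Defs
open import Level using (0ℓ)
import Data.Nat as ℕ
open import Data.Nat using (ℕ; zero; suc; s≤s; z≤n)
import Data.Nat.Properties as ℕ
open import Data.Nat.Combinatorics using (_C_; nCn≡1)
open import Data.Nat.Divisibility using (_∣_; divides)
open import Data.Nat.GCD using (gcd; gcd[m,n]∣m)
open import Data.Nat.Primality using (Prime; prime⇒nonZero)
import Data.Fin as Fin
open import Data.Fin using (Fin; fromℕ; inject₁; punchIn)
open import Data.Fin.Properties using (toℕ-fromℕ; inject₁ℕ<; punchInᵢ≢i) renaming (_≟_ to _≟ᶠ_)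
open import Data.Product using (Σ; _,_; proj₁; proj₂; _×_)
open import Function.Base using (_∘_; id)
open import Function.Bundles using (Inverse)
import Function.Construct.Composition as Composition
import Function.Construct.Symmetry as Symmetry
open import Relation.Nullary using (¬_; Dec; yes; no; contradiction)
open import Relation.Nullary.Decidable using (map′; decidable-stable)
open import Relation.Binary.PropositionalEquality as ≡ using (_≡_; _≢_)
open import Algebra.Bundles using (CommutativeRing; CommutativeMonoid)
import Algebra.Properties.CommutativeMonoid.Sum as CommutativeMonoidSum

module Arithmetic where

  open import Data.Nat using (_+_; _*_; _∸_; _<_; _!; NonZero; nonTrivial⇒≢1)
  open import Data.Nat.Properties
    using (<⇒≱; <⇒≤; <-trans; n<1+n; ∸-monoʳ-<; +-assoc; +-comm; *-comm; _!*_!≢0; 1+n≰n)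
  open import Data.Nat.Combinatorics using (nCk≡n!/k![n-k]!; k![n∸k]!∣n!)
  open import Data.Nat.Divisibility using (∣⇒≤; ∣1⇒≡1; m∣m*n)
  open import Data.Nat.DivMod using (m/n*n≡m)
  open import Data.Nat.GCD using (gcd-GCD; module Bézout)
  open import Data.Nat.Coprimality using (Coprime; coprime⇒gcd≡1)
  open import Data.Nat.Primality using (euclidsLemma; prime⇒nonTrivial; prime⇒irreducible)
  open import Data.Fin using (punchOut)
  open import Data.Fin.Properties using (any?; punchOut-injective; injective⇒≤)
  open import Data.Sum using (inj₁; inj₂)
  open import Data.Product using (∃)
  open import Relation.Binary.PropositionalEquality using (refl; sym; trans; cong; subst)

  prime∤! : ∀ {p k} → Prime p → k < p → ¬ p ∣ k !
  prime∤! {k = zero}  p-prime _   p∣1  = nonTrivial⇒≢1 {{prime⇒nonTrivial p-prime}} (∣1⇒≡1 p∣1)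
  prime∤! {k = suc k} p-prime k<p p∣k! with euclidsLemma (suc k) (k !) p-prime p∣k!
  ... | inj₁ p∣1+k = <⇒≱ k<p (∣⇒≤ p∣1+k)
  ... | inj₂ p∣k!′ = prime∤! p-prime (<-trans (n<1+n k) k<p) p∣k!′

  prime∣C : ∀ {p k} → Prime p → 0 < k → k < p → p ∣ p C k
  prime∣C {p@(suc p-1)} {k} p-prime 0<k k<p with euclidsLemma (p C k) (k ! * (p ∸ k) !) p-prime p∣C*k!*[p∸k]!
    where
    k≤p = <⇒≤ k<p
    p∣C*k!*[p∸k]! : p ∣ (p C k) * (k ! * (p ∸ k) !)
    p∣C*k!*[p∸k]! = subst (p ∣_) (sym C*k!*[p∸k]!≡p!) (m∣m*n (p-1 !))
      where
      C*k!*[p∸k]!≡p! : (p C k) * (k ! * (p ∸ k) !) ≡ p !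
      C*k!*[p∸k]!≡p! = trans (cong (_* (k ! * (p ∸ k) !)) (nCk≡n!/k![n-k]! k≤p))
                             (m/n*n≡m {{k !* (p ∸ k) !≢0}} (k![n∸k]!∣n! k≤p))
  ... | inj₁ p∣C = p∣C
  ... | inj₂ p∣k!*[p∸k]! with euclidsLemma (k !) ((p ∸ k) !) p-prime p∣k!*[p∸k]!
  ...   | inj₁ p∣k!     = contradiction p∣k! (prime∤! p-prime k<p)
  ...   | inj₂ p∣[p∸k]! = contradiction p∣[p∸k]! (prime∤! p-prime (∸-monoʳ-< 0<k (<⇒≤ k<p)))

  prime∤⇒gcd≡1 : ∀ {p n} → Prime p → ¬ p ∣ n → gcd p n ≡ 1
  prime∤⇒gcd≡1 {p} {n} p-prime p∤n = coprime⇒gcd≡1 coprime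
    where
    coprime : Coprime p n
    coprime (d∣p , d∣n) with prime⇒irreducible p-prime d∣p
    ... | inj₁ d≡1 = d≡1
    ... | inj₂ refl = contradiction d∣n p∤n

  module GcdClosure {ℓ} (P : ℕ → Set ℓ) (P0 : P 0) (+-closed : ∀ s t → P s → P t → P (s + t)) where

    *-closed : ∀ k {s} → P s → P (k * s)
    *-closed zero    Ps = P0
    *-closed (suc k) Ps = +-closed _ _ Ps (*-closed k Ps)

    gcd-closed : (∀ s t → P (s + t) → P t → P s) → ∀ a b → P a → P b → P (gcd a b)
    gcd-closed ∸-closed a b Pa Pb with Bézout.identity (gcd-GCD a b)
    ... | Bézout.+- x y eq = ∸-closed _ (y * b) (subst P (sym eq) (*-closed x Pa)) (*-closed y Pb)
    ... | Bézout.-+ x y eq = ∸-closed _ (x * a) (subst P (sym eq) (*-closed y Pb)) (*-closed x Pa)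

    periodic⇒∸-closed : ∀ M → .{{NonZero M}} → (∀ s → P (s + M) → P s) →
                        ∀ s t → P (s + t) → P t → P s
    periodic⇒∸-closed M@(suc M-1) periodic s t Ps+t Pt =
      drop-multiple t s (subst P s+t+[M-1]t≡s+Mt (+-closed _ _ Ps+t (*-closed M-1 Pt)))
      where
      s+t+[M-1]t≡s+Mt : s + t + M-1 * t ≡ s + t * M
      s+t+[M-1]t≡s+Mt = trans (+-assoc s t _) (cong (s +_) (*-comm M t))
      drop-multiple : ∀ k s → P (s + k * M) → P s
      drop-multiple zero    s Ps+0    = subst P (+-comm s 0) Ps+0
      drop-multiple (suc k) s Ps+M+kM = drop-multiple k s (periodic (s + k * M) (subst P s+M+kM≡s+kM+M Ps+M+kM))
        where
        s+M+kM≡s+kM+M : s + (M + k * M) ≡ s + k * M + M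
        s+M+kM≡s+kM+M = trans (cong (s +_) (+-comm M (k * M))) (sym (+-assoc s (k * M) M))

  Fin-injective⇒surjective : ∀ {n} (h : Fin n → Fin n) → (∀ {i j} → h i ≡ h j → i ≡ j) → ∀ j → ∃ λ i → h i ≡ j
  Fin-injective⇒surjective {suc n} h h-injective j with any? (λ i → h i ≟ᶠ j)
  ... | yes hit   = hit
  ... | no missed = contradiction (injective⇒≤ punchOut∘h-injective) 1+n≰n
    where
    j≢h : ∀ i → j ≢ h i
    j≢h i j≡hi = missed (i , sym j≡hi)
    punchOut∘h-injective : ∀ {i i′} → punchOut (j≢h i) ≡ punchOut (j≢h i′) → i ≡ i′
    punchOut∘h-injective eq = h-injective (punchOut-injective (j≢h _) (j≢h _) eq)

open Arithmetic

module FiniteFieldTheory (F : CommutativeRing 0ℓ 0ℓ) where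

  open CommutativeRing F hiding (zero)
  open FF F
  open import Relation.Binary.Reasoning.Setoid setoid
  open import Algebra.Properties.Ring ring using (x+x≈x⇒x≈0)
  open import Algebra.Properties.AbelianGroup +-abelianGroup
    using (inverseʳ-unique; identityʳ-unique; x∙y⁻¹≈ε⇒x≈y; x≈y⇒x∙y⁻¹≈ε; ⁻¹-∙-comm; //-rightDividesˡ; //-rightDividesʳ)
  open import Algebra.Properties.CommutativeSemigroup +-commutativeSemigroup using (interchange)
  open import Algebra.Properties.Semiring.Mult semiring using (×-assoc-*; ×1-homo-*; ×-homo-1; ×-homo-+; ×-congʳ; ×-congˡ)
    renaming (_×_ to _·_)
  import Algebra.Properties.Semiring.Exp semiring as Exp
  open Exp using () renaming (_^_ to _^ᴱ_)
  import Algebra.Properties.CommutativeSemiring.Exp commutativeSemiring as CExp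
  import Algebra.Properties.CommutativeSemiring.Binomial commutativeSemiring as Binomial
  open CommutativeMonoidSum +-commutativeMonoid
    using (sum; sum-init-last; sum-cong-≋; sum-replicate-zero; sum-replicate; ∑-distrib-+)
  module Product = CommutativeMonoidSum *-commutativeMonoid
  open import Algebra.Properties.CommutativeSemigroup *-commutativeSemigroup using (x∙yz≈y∙xz)

  ^≈^ᴱ : ∀ x n → x ^ n ≈ x ^ᴱ n
  ^≈^ᴱ x zero    = refl
  ^≈^ᴱ x (suc n) = *-congˡ (^≈^ᴱ x n)

  ^-congˡ : ∀ n {x y} → x ≈ y → x ^ n ≈ y ^ n
  ^-congˡ zero    x≈y = refl
  ^-congˡ (suc n) x≈y = *-cong x≈y (^-congˡ n x≈y)

  ^-congʳ : ∀ x {m n} → m ≡ n → x ^ m ≈ x ^ n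
  ^-congʳ x ≡.refl = refl

  ^-homo-* : ∀ x m n → x ^ (m ℕ.+ n) ≈ x ^ m * x ^ n
  ^-homo-* x m n = begin
    x ^ (m ℕ.+ n)      ≈⟨ ^≈^ᴱ x (m ℕ.+ n) ⟩
    x ^ᴱ (m ℕ.+ n)     ≈⟨ Exp.^-homo-* x m n ⟩
    x ^ᴱ m * x ^ᴱ n    ≈⟨ *-cong (^≈^ᴱ x m) (^≈^ᴱ x n) ⟨
    x ^ m * x ^ n      ∎

  ^-distrib-* : ∀ x y n → (x * y) ^ n ≈ x ^ n * y ^ n
  ^-distrib-* x y n = begin
    (x * y) ^ n        ≈⟨ ^≈^ᴱ (x * y) n ⟩
    (x * y) ^ᴱ n       ≈⟨ CExp.^-distrib-* x y n ⟩
    x ^ᴱ n * y ^ᴱ n    ≈⟨ *-cong (^≈^ᴱ x n) (^≈^ᴱ y n) ⟨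
    x ^ n * y ^ n      ∎

  ^-assocʳ : ∀ x m n → (x ^ m) ^ n ≈ x ^ (m ℕ.* n)
  ^-assocʳ x m n = begin
    (x ^ m) ^ n        ≈⟨ ^≈^ᴱ (x ^ m) n ⟩
    (x ^ m) ^ᴱ n       ≈⟨ Exp.^-congˡ n (^≈^ᴱ x m) ⟩
    (x ^ᴱ m) ^ᴱ n      ≈⟨ Exp.^-assocʳ x m n ⟩
    x ^ᴱ (m ℕ.* n)     ≈⟨ ^≈^ᴱ x (m ℕ.* n) ⟨
    x ^ (m ℕ.* n)      ∎

  ^-comm : ∀ x m n → (x ^ m) ^ n ≈ (x ^ n) ^ m
  ^-comm x m n = trans (^-assocʳ x m n) (trans (^-congʳ x (ℕ.*-comm m n)) (sym (^-assocʳ x n m)))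

  ^-^-+ : ∀ x b s t → x ^ (b ℕ.^ (s ℕ.+ t)) ≈ (x ^ (b ℕ.^ s)) ^ (b ℕ.^ t)
  ^-^-+ x b s t = trans (^-congʳ x (ℕ.^-distribˡ-+-* b s t)) (sym (^-assocʳ x (b ℕ.^ s) (b ℕ.^ t)))

  1^n≈1 : ∀ n → 1# ^ n ≈ 1#
  1^n≈1 zero    = refl
  1^n≈1 (suc n) = trans (*-identityˡ _) (1^n≈1 n)

  fixed⇒fixedⁱ : ∀ {x q} → x ^ q ≈ x → ∀ i → x ^ (q ℕ.^ i) ≈ x
  fixed⇒fixedⁱ x^q≈x zero    = *-identityʳ _
  fixed⇒fixedⁱ {x} {q} x^q≈x (suc i) = begin
    x ^ (q ℕ.* q ℕ.^ i)   ≈⟨ ^-assocʳ x q (q ℕ.^ i) ⟨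
    (x ^ q) ^ (q ℕ.^ i)   ≈⟨ ^-congˡ (q ℕ.^ i) x^q≈x ⟩
    x ^ (q ℕ.^ i)         ≈⟨ fixed⇒fixedⁱ x^q≈x i ⟩
    x                     ∎

  ·≈·1* : ∀ n x → n · x ≈ (n · 1#) * x
  ·≈·1* n x = sym (trans (×-assoc-* n 1# x) (×-congʳ n (*-identityˡ x)))

  ·1-homo-^ : ∀ a k → (a ℕ.^ k) · 1# ≈ (a · 1#) ^ k
  ·1-homo-^ a zero    = +-identityʳ 1#
  ·1-homo-^ a (suc k) = trans (×1-homo-* a (a ℕ.^ k)) (*-congˡ (·1-homo-^ a k))

  ^≈1-gcd : ∀ g a b → g ^ a ≈ 1# → g ^ b ≈ 1# → g ^ gcd a b ≈ 1#
  ^≈1-gcd g = GcdClosure.gcd-closed (λ s → g ^ s ≈ 1#) refl +-closed ∸-closed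
    where
    +-closed : ∀ s t → g ^ s ≈ 1# → g ^ t ≈ 1# → g ^ (s ℕ.+ t) ≈ 1#
    +-closed s t gˢ≈1 gᵗ≈1 = trans (^-homo-* g s t) (trans (*-cong gˢ≈1 gᵗ≈1) (*-identityˡ 1#))
    ∸-closed : ∀ s t → g ^ (s ℕ.+ t) ≈ 1# → g ^ t ≈ 1# → g ^ s ≈ 1#
    ∸-closed s t gˢ⁺ᵗ≈1 gᵗ≈1 = begin
      g ^ s            ≈⟨ *-identityʳ _ ⟨
      g ^ s * 1#       ≈⟨ *-congˡ gᵗ≈1 ⟨
      g ^ s * g ^ t    ≈⟨ ^-homo-* g s t ⟨
      g ^ (s ℕ.+ t)    ≈⟨ gˢ⁺ᵗ≈1 ⟩
      1#               ∎

  ·1≈0-gcd : ∀ a b → a · 1# ≈ 0# → b · 1# ≈ 0# → gcd a b · 1# ≈ 0#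
  ·1≈0-gcd = GcdClosure.gcd-closed (λ s → s · 1# ≈ 0#) refl +-closed ∸-closed
    where
    +-closed : ∀ s t → s · 1# ≈ 0# → t · 1# ≈ 0# → (s ℕ.+ t) · 1# ≈ 0#
    +-closed s t s≈0 t≈0 = trans (×-homo-+ 1# s t) (trans (+-cong s≈0 t≈0) (+-identityˡ 0#))
    ∸-closed : ∀ s t → (s ℕ.+ t) · 1# ≈ 0# → t · 1# ≈ 0# → s · 1# ≈ 0#
    ∸-closed s t s+t≈0 t≈0 = begin
      s · 1#             ≈⟨ +-identityʳ _ ⟨
      s · 1# + 0#        ≈⟨ +-congˡ t≈0 ⟨
      s · 1# + t · 1#    ≈⟨ ×-homo-+ 1# s t ⟨
      (s ℕ.+ t) · 1#     ≈⟨ s+t≈0 ⟩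
      0#                 ∎

  module AdditiveHom (φ : Carrier → Carrier) (φ-cong : ∀ {x y} → x ≈ y → φ x ≈ φ y)
                     (+-homo : ∀ x y → φ (x + y) ≈ φ x + φ y) where

    0#-homo : φ 0# ≈ 0#
    0#-homo = x+x≈x⇒x≈0 (φ 0#) (trans (sym (+-homo 0# 0#)) (φ-cong (+-identityˡ 0#)))

    -‿homo : ∀ x → φ (- x) ≈ - φ x
    -‿homo x = inverseʳ-unique (φ x) (φ (- x))
      (trans (sym (+-homo x (- x))) (trans (φ-cong (-‿inverseʳ x)) 0#-homo))

    sub-homo : ∀ x y → φ (x - y) ≈ φ x - φ y
    sub-homo x y = trans (+-homo x (- y)) (+-congˡ (-‿homo y))

  ∣⇒·≈0 : ∀ {p k} → p · 1# ≈ 0# → p ∣ k → ∀ x → k · x ≈ 0#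
  ∣⇒·≈0 {p} char (divides j ≡.refl) x = begin
    (j ℕ.* p) · x              ≈⟨ ·≈·1* (j ℕ.* p) x ⟩
    ((j ℕ.* p) · 1#) * x       ≈⟨ *-congʳ (×1-homo-* j p) ⟩
    ((j · 1#) * (p · 1#)) * x  ≈⟨ *-congʳ (*-congˡ char) ⟩
    ((j · 1#) * 0#) * x        ≈⟨ *-congʳ (zeroʳ _) ⟩
    0# * x                     ≈⟨ zeroˡ x ⟩
    0#                         ∎

  frobenius-+ : ∀ {p} → Prime p → p · 1# ≈ 0# → ∀ x y → (x + y) ^ p ≈ x ^ p + y ^ p
  frobenius-+ {zero} p-prime with () ← prime⇒nonZero p-prime
  frobenius-+ {p@(suc p-1)} p-prime char x y = begin
    (x + y) ^ p                                           ≈⟨ ^≈^ᴱ (x + y) p ⟩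
    (x + y) ^ᴱ p                                          ≈⟨ Binomial.theorem p x y ⟩
    term Fin.zero + sum (λ i → term (Fin.suc i))          ≈⟨ +-cong first-term (sum-init-last (λ i → term (Fin.suc i))) ⟩
    y ^ᴱ p + (sum interior + term (Fin.suc (fromℕ p-1)))  ≈⟨ +-congˡ (+-cong interior≈0 (last-term _ (toℕ-fromℕ p-1))) ⟩
    y ^ᴱ p + (0# + x ^ᴱ p)                                ≈⟨ +-congˡ (+-identityˡ _) ⟩
    y ^ᴱ p + x ^ᴱ p                                       ≈⟨ +-comm _ _ ⟩
    x ^ᴱ p + y ^ᴱ p                                       ≈⟨ +-cong (^≈^ᴱ x p) (^≈^ᴱ y p) ⟨
    x ^ p + y ^ p                                         ∎
    where
    term = Binomial.binomialTerm x y p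
    interior : Fin p-1 → Carrier
    interior i = term (Fin.suc (inject₁ i))

    first-term : term Fin.zero ≈ y ^ᴱ p
    first-term = trans (×-homo-1 _) (*-identityˡ _)

    interior≈0 : sum interior ≈ 0#
    interior≈0 = trans (sum-cong-≋ (λ i → ∣⇒·≈0 char (prime∣C p-prime (s≤s z≤n) (s≤s (inject₁ℕ< i))) _))
                       (sum-replicate-zero p-1)

    last-term : ∀ j → j ≡ p-1 → (p C suc j) · (x ^ᴱ suc j * y ^ᴱ (p-1 ℕ.∸ j)) ≈ x ^ᴱ p
    last-term .p-1 ≡.refl = begin
      (p C p) · (x ^ᴱ p * y ^ᴱ (p-1 ℕ.∸ p-1))  ≈⟨ ×-congˡ (nCn≡1 p) ⟩
      1 · (x ^ᴱ p * y ^ᴱ (p-1 ℕ.∸ p-1))        ≈⟨ ×-homo-1 _ ⟩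
      x ^ᴱ p * y ^ᴱ (p-1 ℕ.∸ p-1)              ≈⟨ *-congˡ (Exp.^-congʳ y (ℕ.n∸n≡0 p-1)) ⟩
      x ^ᴱ p * 1#                              ≈⟨ *-identityʳ _ ⟩
      x ^ᴱ p                                   ∎

  module Characteristic {p} (p-prime : Prime p) (char : p · 1# ≈ 0#) where

    frobeniusⁱ-+ : ∀ k x y → (x + y) ^ (p ℕ.^ k) ≈ x ^ (p ℕ.^ k) + y ^ (p ℕ.^ k)
    frobeniusⁱ-+ zero    x y = trans (*-identityʳ _) (sym (+-cong (*-identityʳ x) (*-identityʳ y)))
    frobeniusⁱ-+ (suc k) x y = begin
      (x + y) ^ (p ℕ.* p ℕ.^ k)                 ≈⟨ ^-assocʳ (x + y) p (p ℕ.^ k) ⟨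
      ((x + y) ^ p) ^ (p ℕ.^ k)                 ≈⟨ ^-congˡ (p ℕ.^ k) (frobenius-+ p-prime char x y) ⟩
      (x ^ p + y ^ p) ^ (p ℕ.^ k)               ≈⟨ frobeniusⁱ-+ k (x ^ p) (y ^ p) ⟩
      (x ^ p) ^ (p ℕ.^ k) + (y ^ p) ^ (p ℕ.^ k) ≈⟨ +-cong (^-assocʳ x p (p ℕ.^ k)) (^-assocʳ y p (p ℕ.^ k)) ⟩
      x ^ (p ℕ.* p ℕ.^ k) + y ^ (p ℕ.* p ℕ.^ k) ∎

    module Frobenius k = AdditiveHom (_^ (p ℕ.^ k)) (^-congˡ (p ℕ.^ k)) (frobeniusⁱ-+ k)

    module _ (r : ℕ) (c : Carrier) where

      L-+ : ∀ x y → L p r c (x + y) ≈ L p r c x + L p r c y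
      L-+ x y = begin
        (x + y) ^ R - c * (x + y)             ≈⟨ +-cong (frobeniusⁱ-+ r x y) (-‿cong (distribˡ c x y)) ⟩
        (x ^ R + y ^ R) - (c * x + c * y)     ≈⟨ +-congˡ (⁻¹-∙-comm (c * x) (c * y)) ⟨
        (x ^ R + y ^ R) + (- (c * x) - c * y) ≈⟨ interchange _ _ _ _ ⟩
        (x ^ R - c * x) + (y ^ R - c * y)     ∎
        where R = p ℕ.^ r

      L-cong : ∀ {x y} → x ≈ y → L p r c x ≈ L p r c y
      L-cong x≈y = +-cong (^-congˡ (p ℕ.^ r) x≈y) (-‿cong (*-congˡ x≈y))

      module LHom = AdditiveHom (L p r c) L-cong L-+

    module Trace (m : ℕ) where

      q = p ℕ.^ m

      frobenius-qⁱ-+ : ∀ i x y → (x + y) ^ (q ℕ.^ i) ≈ x ^ (q ℕ.^ i) + y ^ (q ℕ.^ i)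
      frobenius-qⁱ-+ i x y = begin
        (x + y) ^ (q ℕ.^ i)                            ≈⟨ ^-congʳ (x + y) q^i≡p^mi ⟩
        (x + y) ^ (p ℕ.^ (m ℕ.* i))                    ≈⟨ frobeniusⁱ-+ (m ℕ.* i) x y ⟩
        x ^ (p ℕ.^ (m ℕ.* i)) + y ^ (p ℕ.^ (m ℕ.* i))  ≈⟨ +-cong (^-congʳ x q^i≡p^mi) (^-congʳ y q^i≡p^mi) ⟨
        x ^ (q ℕ.^ i) + y ^ (q ℕ.^ i)                  ∎
        where q^i≡p^mi = ℕ.^-*-assoc p m i

      trace-cong : ∀ n {x y} → x ≈ y → trace q n x ≈ trace q n y
      trace-cong zero    x≈y = refl
      trace-cong (suc n) x≈y = +-cong (trace-cong n x≈y) (^-congˡ (q ℕ.^ n) x≈y)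

      trace-+ : ∀ n x y → trace q n (x + y) ≈ trace q n x + trace q n y
      trace-+ zero    x y = sym (+-identityʳ 0#)
      trace-+ (suc n) x y = begin
        trace q n (x + y) + (x + y) ^ (q ℕ.^ n)
          ≈⟨ +-cong (trace-+ n x y) (frobenius-qⁱ-+ n x y) ⟩
        (trace q n x + trace q n y) + (x ^ (q ℕ.^ n) + y ^ (q ℕ.^ n))
          ≈⟨ interchange _ _ _ _ ⟩
        (trace q n x + x ^ (q ℕ.^ n)) + (trace q n y + y ^ (q ℕ.^ n)) ∎

      module TraceHom n = AdditiveHom (trace q n) (trace-cong n) (trace-+ n)

      trace-*ˡ : ∀ {c} → c ^ q ≈ c → ∀ n x → trace q n (c * x) ≈ c * trace q n x
      trace-*ˡ c^q≈c zero    x = sym (zeroʳ _)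
      trace-*ˡ {c} c^q≈c (suc n) x = begin
        trace q n (c * x) + (c * x) ^ (q ℕ.^ n)               ≈⟨ +-cong (trace-*ˡ c^q≈c n x) (^-distrib-* c x (q ℕ.^ n)) ⟩
        c * trace q n x + c ^ (q ℕ.^ n) * x ^ (q ℕ.^ n)       ≈⟨ +-congˡ (*-congʳ (fixed⇒fixedⁱ c^q≈c n)) ⟩
        c * trace q n x + c * x ^ (q ℕ.^ n)                   ≈⟨ distribˡ c _ _ ⟨
        c * (trace q n x + x ^ (q ℕ.^ n))                     ∎

      trace-frobenius : ∀ r n x → trace q n (x ^ (p ℕ.^ r)) ≈ trace q n x ^ (p ℕ.^ r)
      trace-frobenius r zero    x = sym (Frobenius.0#-homo r)
      trace-frobenius r (suc n) x = begin
        trace q n (x ^ (p ℕ.^ r)) + (x ^ (p ℕ.^ r)) ^ (q ℕ.^ n)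
          ≈⟨ +-cong (trace-frobenius r n x) (^-comm x (p ℕ.^ r) (q ℕ.^ n)) ⟩
        trace q n x ^ (p ℕ.^ r) + (x ^ (q ℕ.^ n)) ^ (p ℕ.^ r)
          ≈⟨ frobeniusⁱ-+ r _ _ ⟨
        (trace q n x + x ^ (q ℕ.^ n)) ^ (p ℕ.^ r) ∎

      trace-L : ∀ {r c} → c ^ q ≈ c → ∀ n x → trace q n (L p r c x) ≈ L p r c (trace q n x)
      trace-L {r} {c} c^q≈c n x = begin
        trace q n (x ^ (p ℕ.^ r) - c * x)                   ≈⟨ TraceHom.sub-homo n _ _ ⟩
        trace q n (x ^ (p ℕ.^ r)) - trace q n (c * x)       ≈⟨ +-cong (trace-frobenius r n x) (-‿cong (trace-*ˡ c^q≈c n x)) ⟩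
        trace q n x ^ (p ℕ.^ r) - c * trace q n x           ∎

      trace-fixed : ∀ {x} → x ^ q ≈ x → ∀ n → trace q n x ≈ n · x
      trace-fixed x^q≈x zero    = refl
      trace-fixed x^q≈x (suc n) = trans (+-cong (trace-fixed x^q≈x n) (fixed⇒fixedⁱ x^q≈x n)) (+-comm _ _)

  automorphism : (f g : Carrier → Carrier) → (∀ {x y} → x ≈ y → f x ≈ f y) → (∀ {x y} → x ≈ y → g x ≈ g y) →
                 (∀ x → f (g x) ≈ x) → (∀ x → g (f x) ≈ x) → Inverse setoid setoid
  automorphism f g f-cong g-cong fg≈id gf≈id = record
    { to        = f
    ; from      = g
    ; to-cong   = f-cong
    ; from-cong = g-cong
    ; inverse   = strictlyInverseˡ⇒inverseˡ f-cong fg≈id , strictlyInverseʳ⇒inverseʳ g-cong gf≈id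
    }
    where open import Function.Consequences.Setoid setoid setoid

  translation : Carrier → Inverse setoid setoid
  translation a = automorphism (_+ a) (_- a) +-congʳ +-congʳ (//-rightDividesˡ a) (//-rightDividesʳ a)

  module Field (isField : IsField) where

    1≉0 : ¬ 1# ≈ 0#
    1≉0 = proj₁ isField

    *-cancelˡ : ∀ {x y z} → ¬ x ≈ 0# → x * y ≈ x * z → y ≈ z
    *-cancelˡ {x} {y} {z} x≉0 xy≈xz with proj₂ isField x x≉0
    ... | x⁻¹ , xx⁻¹≈1 = begin
      y                ≈⟨ *-identityˡ y ⟨
      1# * y           ≈⟨ *-congʳ (trans (*-comm x⁻¹ x) xx⁻¹≈1) ⟨
      (x⁻¹ * x) * y    ≈⟨ *-assoc x⁻¹ x y ⟩
      x⁻¹ * (x * y)    ≈⟨ *-congˡ xy≈xz ⟩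
      x⁻¹ * (x * z)    ≈⟨ *-assoc x⁻¹ x z ⟨
      (x⁻¹ * x) * z    ≈⟨ *-congʳ (trans (*-comm x⁻¹ x) xx⁻¹≈1) ⟩
      1# * z           ≈⟨ *-identityˡ z ⟩
      z                ∎

    *-cancelʳ : ∀ {x y z} → ¬ x ≈ 0# → y * x ≈ z * x → y ≈ z
    *-cancelʳ {x} {y} {z} x≉0 yx≈zx = *-cancelˡ x≉0 (trans (*-comm x y) (trans yx≈zx (*-comm z x)))

    *-≉0 : ∀ {x y} → ¬ x ≈ 0# → ¬ y ≈ 0# → ¬ x * y ≈ 0#
    *-≉0 {x} x≉0 y≉0 xy≈0 = y≉0 (*-cancelˡ x≉0 (trans xy≈0 (sym (zeroʳ x))))

    ^-≉0 : ∀ n {x} → ¬ x ≈ 0# → ¬ x ^ n ≈ 0#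
    ^-≉0 zero    x≉0 = 1≉0
    ^-≉0 (suc n) x≉0 = *-≉0 x≉0 (^-≉0 n x≉0)

    scaling : ∀ {a} → ¬ a ≈ 0# → Inverse setoid setoid
    scaling {a} a≉0 with proj₂ isField a a≉0
    ... | a⁻¹ , aa⁻¹≈1 = automorphism (a *_) (a⁻¹ *_) *-congˡ *-congˡ (cancels aa⁻¹≈1)
                           (cancels (trans (*-comm a⁻¹ a) aa⁻¹≈1))
      where
      cancels : ∀ {b c} → b * c ≈ 1# → ∀ x → b * (c * x) ≈ x
      cancels {b} {c} bc≈1 x = trans (sym (*-assoc b c x)) (trans (*-congʳ bc≈1) (*-identityˡ x))

  module FiniteField (isField : IsField) {N} (card : HasCard (suc N)) where

    open Field isField
    open Inverse card using (to; from; to-cong; from-cong; strictlyInverseˡ; strictlyInverseʳ)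

    to-injective : ∀ {x y} → to x ≡ to y → x ≈ y
    to-injective {x} {y} tx≡ty = trans (sym (strictlyInverseʳ x)) (trans (from-cong tx≡ty) (strictlyInverseʳ y))

    _≟_ : ∀ x y → Dec (x ≈ y)
    x ≟ y = map′ to-injective to-cong (to x ≟ᶠ to y)

    sum-invariant : (M : CommutativeMonoid 0ℓ 0ℓ) (h : Carrier → CommutativeMonoid.Carrier M) →
                    (∀ {x y} → x ≈ y → CommutativeMonoid._≈_ M (h x) (h y)) → (σ : Inverse setoid setoid) →
                    CommutativeMonoid._≈_ M (CommutativeMonoidSum.sum M (h ∘ from))
                                            (CommutativeMonoidSum.sum M (h ∘ Inverse.to σ ∘ from))
    sum-invariant M h h-cong σ = M.trans (ΣM.∑-permute (h ∘ from) conjugate)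
                                         (ΣM.sum-cong-≋ (λ i → h-cong (strictlyInverseʳ (Inverse.to σ (from i)))))
      where
      module M = CommutativeMonoid M
      module ΣM = CommutativeMonoidSum M
      conjugate = Composition.inverse (Symmetry.inverse card) (Composition.inverse σ card)

    characteristic : suc N · 1# ≈ 0#
    characteristic = identityʳ-unique S (suc N · 1#) (begin
      S + suc N · 1#              ≈⟨ +-congˡ (sum-replicate (suc N) {1#}) ⟨
      S + sum {suc N} (λ _ → 1#)  ≈⟨ ∑-distrib-+ from (λ _ → 1#) ⟨
      sum (λ i → from i + 1#)     ≈⟨ sum-invariant +-commutativeMonoid id id (translation 1#) ⟨
      S                           ∎)
      where S = sum from

    ^≈0⇒≈0 : ∀ n {x} → x ^ n ≈ 0# → x ≈ 0#
    ^≈0⇒≈0 n {x} xⁿ≈0 = decidable-stable (x ≟ 0#) (λ x≉0 → ^-≉0 n x≉0 xⁿ≈0)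

    unzero : Carrier → Carrier
    unzero x with x ≟ 0#
    ... | yes _ = 1#
    ... | no _  = x

    unzero-≈0 : ∀ {x} → x ≈ 0# → unzero x ≈ 1#
    unzero-≈0 {x} x≈0 with x ≟ 0#
    ... | yes _   = refl
    ... | no x≉0  = contradiction x≈0 x≉0

    unzero-≉0 : ∀ {x} → ¬ x ≈ 0# → unzero x ≈ x
    unzero-≉0 {x} x≉0 with x ≟ 0#
    ... | yes x≈0 = contradiction x≈0 x≉0
    ... | no _    = refl

    unzero-cong : ∀ {x y} → x ≈ y → unzero x ≈ unzero y
    unzero-cong {x} {y} x≈y with x ≟ 0#
    ... | yes x≈0 = sym (unzero-≈0 (trans (sym x≈y) x≈0))
    ... | no x≉0  = trans x≈y (sym (unzero-≉0 (λ y≈0 → x≉0 (trans x≈y y≈0))))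

    unzero-nonzero : ∀ x → ¬ unzero x ≈ 0#
    unzero-nonzero x with x ≟ 0#
    ... | yes _  = 1≉0
    ... | no x≉0 = x≉0

    ∏-≉0 : ∀ {n} (f : Fin n → Carrier) → (∀ i → ¬ f i ≈ 0#) → ¬ Product.sum f ≈ 0#
    ∏-≉0 {zero}  f f≉0 = 1≉0
    ∏-≉0 {suc n} f f≉0 = *-≉0 (f≉0 Fin.zero) (∏-≉0 (f ∘ Fin.suc) (f≉0 ∘ Fin.suc))

    ∏-swap-at : ∀ {n} (f g : Fin (suc n) → Carrier) i → (∀ j → j ≢ i → f j ≈ g j) →
                f i * Product.sum g ≈ g i * Product.sum f
    ∏-swap-at f g i f≈g = begin
      f i * Product.sum g                        ≈⟨ *-congˡ (Product.sum-remove g) ⟩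
      f i * (g i * Product.sum (g ∘ punchIn i))  ≈⟨ x∙yz≈y∙xz (f i) (g i) _ ⟩
      g i * (f i * Product.sum (g ∘ punchIn i))  ≈⟨ *-congˡ (*-congˡ (Product.sum-cong-≋ (λ j → f≈g (punchIn i j) (punchInᵢ≢i i j)))) ⟨
      g i * (f i * Product.sum (f ∘ punchIn i))  ≈⟨ *-congˡ (Product.sum-remove f) ⟨
      g i * Product.sum f                        ∎

    -- Scaling by a ≉ 0 permutes the field and fixes 0, so comparing the products of unzero before
    -- and after scaling gives a ^ (suc N) = a.
    fermat : ∀ a → a ^ suc N ≈ a
    fermat a with a ≟ 0#
    ... | yes a≈0 = trans (*-congʳ a≈0) (trans (zeroˡ _) (sym a≈0))
    ... | no a≉0  = sym (*-cancelʳ (∏-≉0 (unzero ∘ from) (unzero-nonzero ∘ from)) (begin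
      a * P                              ≈⟨ *-congˡ (sum-invariant *-commutativeMonoid unzero unzero-cong (scaling a≉0)) ⟩
      a * Product.sum g                  ≈⟨ *-congʳ (trans (*-congˡ (unzero-≈0 (strictlyInverseʳ 0#))) (*-identityʳ a)) ⟨
      f i₀ * Product.sum g               ≈⟨ ∏-swap-at f g i₀ f≈g ⟩
      g i₀ * Product.sum f               ≈⟨ *-congʳ (unzero-≈0 (trans (*-congˡ (strictlyInverseʳ 0#)) (zeroʳ a))) ⟩
      1# * Product.sum f                 ≈⟨ *-identityˡ _ ⟩
      Product.sum f                      ≈⟨ Product.∑-distrib-+ (λ _ → a) (unzero ∘ from) ⟩
      Product.sum {suc N} (λ _ → a) * P  ≈⟨ *-congʳ (trans (Product.sum-replicate (suc N) {a}) (sym (^≈^ᴱ a (suc N)))) ⟩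
      a ^ suc N * P                      ∎))
      where
      P = Product.sum (unzero ∘ from)
      f g : Fin (suc N) → Carrier
      f i = a * unzero (from i)
      g i = unzero (a * from i)
      i₀ = to 0#
      f≈g : ∀ j → j ≢ i₀ → f j ≈ g j
      f≈g j j≢i₀ = trans (*-congˡ (unzero-≉0 from-j≉0)) (sym (unzero-≉0 (*-≉0 a≉0 from-j≉0)))
        where
        from-j≉0 : ¬ from j ≈ 0#
        from-j≉0 from-j≈0 = j≢i₀ (≡.trans (≡.sym (strictlyInverseˡ j)) (to-cong from-j≈0))

    characteristic-root : ∀ {p k} → suc N ≡ p ℕ.^ k → p · 1# ≈ 0#
    characteristic-root {p} {k} card≡pᵏ =
      ^≈0⇒≈0 k (trans (sym (·1-homo-^ p k)) (trans (×-congˡ (≡.sym card≡pᵏ)) characteristic))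

    module _ {S : Carrier → Set} (S? : ∀ x → Dec (S x)) (S-resp : ∀ {x y} → x ≈ y → S x → S y)
             {f : Carrier → Carrier} (f-into : ∀ x → S x → S (f x))
             (f-injective : ∀ x y → S x → S y → f x ≈ f y → x ≈ y) where

      private
        extension : Fin (suc N) → Fin (suc N)
        extension i with S? (from i)
        ... | yes _ = to (f (from i))
        ... | no _  = i

        into-S : ∀ {x i} → S x → to (f x) ≡ i → S (from i)
        into-S {x} Sx fx≡i = S-resp (trans (sym (strictlyInverseʳ (f x))) (from-cong fx≡i)) (f-into x Sx)

        extension-injective : ∀ {i j} → extension i ≡ extension j → i ≡ j
        extension-injective {i} {j} with S? (from i) | S? (from j)
        ... | yes Si | yes Sj = λ eq → ≡.trans (≡.sym (strictlyInverseˡ i))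
                                  (≡.trans (to-cong (f-injective _ _ Si Sj (to-injective eq))) (strictlyInverseˡ j))
        ... | yes Si | no ¬Sj = λ eq → contradiction (into-S Si eq) ¬Sj
        ... | no ¬Si | yes Sj = λ eq → contradiction (into-S Sj (≡.sym eq)) ¬Si
        ... | no _   | no _   = id

      injective⇒surjective : ∀ y → S y → Σ Carrier λ x → S x × f x ≈ y
      injective⇒surjective y Sy with Fin-injective⇒surjective extension extension-injective (to y)
      ... | i , ext-i≡ty with S? (from i)
      ...   | yes Si = from i , Si , to-injective ext-i≡ty
      ...   | no ¬Si = contradiction (S-resp (trans (sym (strictlyInverseʳ y)) (from-cong (≡.sym ext-i≡ty))) Sy) ¬Si

  module TraceKernel (isField : IsField) {N} (card : HasCard (suc N)) {p} (p-prime : Prime p)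
                     {m n r : ℕ} .{{_ : ℕ.NonZero (n ℕ.* m)}} (card≡pⁿᵐ : suc N ≡ p ℕ.^ (n ℕ.* m))
                     (gcd-eq : gcd (n ℕ.* m) r ≡ gcd m r) (p∤n : ¬ p ∣ n)
                     (coprime : gcd n (p ℕ.^ gcd m r ℕ.∸ 1) ≡ 1)
                     {c} (c^q≈c : c ^ (p ℕ.^ m) ≈ c) where

    open Field isField
    open FiniteField isField card

    char : p · 1# ≈ 0#
    char = characteristic-root {p} {n ℕ.* m} card≡pⁿᵐ

    periodic : ∀ x → x ^ (p ℕ.^ (n ℕ.* m)) ≈ x
    periodic x = trans (^-congʳ x (≡.sym card≡pⁿᵐ)) (fermat x)

    open Characteristic p-prime char
    open Trace m

    d = gcd m r

    record FrobeniusEigen (z : Carrier) (s : ℕ) : Set where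
      constructor eigen
      field
        eigenvalue       : Carrier
        eigenvalue-fixed : eigenvalue ^ q ≈ eigenvalue
        eigen-eq         : z ^ (p ℕ.^ s) ≈ eigenvalue * z

    module _ {z : Carrier} where

      eigen-0 : FrobeniusEigen z 0
      eigen-0 = eigen 1# (1^n≈1 q) (trans (*-identityʳ z) (sym (*-identityˡ z)))

      eigen-+ : ∀ s t → FrobeniusEigen z s → FrobeniusEigen z t → FrobeniusEigen z (s ℕ.+ t)
      eigen-+ s t (eigen a a^q≈a z^pˢ≈az) (eigen b b^q≈b z^pᵗ≈bz) = eigen (a ^ (p ℕ.^ t) * b) fixed (begin
        z ^ (p ℕ.^ (s ℕ.+ t))             ≈⟨ ^-^-+ z p s t ⟩
        (z ^ (p ℕ.^ s)) ^ (p ℕ.^ t)       ≈⟨ ^-congˡ (p ℕ.^ t) z^pˢ≈az ⟩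
        (a * z) ^ (p ℕ.^ t)               ≈⟨ ^-distrib-* a z (p ℕ.^ t) ⟩
        a ^ (p ℕ.^ t) * z ^ (p ℕ.^ t)     ≈⟨ *-congˡ z^pᵗ≈bz ⟩
        a ^ (p ℕ.^ t) * (b * z)           ≈⟨ *-assoc _ b z ⟨
        a ^ (p ℕ.^ t) * b * z             ∎)
        where
        fixed : (a ^ (p ℕ.^ t) * b) ^ q ≈ a ^ (p ℕ.^ t) * b
        fixed = trans (^-distrib-* _ b q) (*-cong (trans (^-comm a (p ℕ.^ t) q) (^-congˡ (p ℕ.^ t) a^q≈a)) b^q≈b)

      eigen-periodic : ∀ s → FrobeniusEigen z (s ℕ.+ n ℕ.* m) → FrobeniusEigen z s
      eigen-periodic s (eigen a a^q≈a z^pˢ⁺ⁿᵐ≈az) =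
        eigen a a^q≈a (trans (sym (periodic _)) (trans (sym (^-^-+ z p s (n ℕ.* m))) z^pˢ⁺ⁿᵐ≈az))

      eigen-gcd : ∀ a b → FrobeniusEigen z a → FrobeniusEigen z b → FrobeniusEigen z (gcd a b)
      eigen-gcd = gcd-closed (periodic⇒∸-closed (n ℕ.* m) eigen-periodic)
        where open GcdClosure (FrobeniusEigen z) eigen-0 eigen-+

      eigen-multiple : ∀ k s → FrobeniusEigen z s → FrobeniusEigen z (k ℕ.* s)
      eigen-multiple k s = GcdClosure.*-closed (FrobeniusEigen z) eigen-0 eigen-+ k

    module _ {z : Carrier} (z≉0 : ¬ z ≈ 0#) (eigen-r : FrobeniusEigen z r) where

      eigen-d : FrobeniusEigen z d
      eigen-d = ≡.subst (FrobeniusEigen z) gcd-eq (eigen-gcd (n ℕ.* m) r eigen-nm eigen-r)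
        where
        eigen-nm : FrobeniusEigen z (n ℕ.* m)
        eigen-nm = eigen 1# (1^n≈1 q) (trans (periodic z) (sym (*-identityˡ z)))

      eigen-m : FrobeniusEigen z m
      eigen-m with gcd[m,n]∣m m r
      ... | divides k m≡kd = ≡.subst (FrobeniusEigen z) (≡.sym m≡kd) (eigen-multiple k d eigen-d)

      open FrobeniusEigen eigen-m renaming (eigenvalue to g; eigenvalue-fixed to g^q≈g; eigen-eq to z^q≈gz)

      g≉0 : ¬ g ≈ 0#
      g≉0 g≈0 = ^-≉0 q z≉0 (trans z^q≈gz (trans (*-congʳ g≈0) (zeroˡ z)))

      g^[p^d]≈g : g ^ (p ℕ.^ d) ≈ g
      g^[p^d]≈g = *-cancelʳ ez≉0 (begin
        g ^ P * (e * z)   ≈⟨ *-congˡ z^P≈ez ⟨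
        g ^ P * z ^ P     ≈⟨ ^-distrib-* g z P ⟨
        (g * z) ^ P       ≈⟨ ^-congˡ P z^q≈gz ⟨
        (z ^ q) ^ P       ≈⟨ ^-comm z q P ⟩
        (z ^ P) ^ q       ≈⟨ ^-congˡ q z^P≈ez ⟩
        (e * z) ^ q       ≈⟨ ^-distrib-* e z q ⟩
        e ^ q * z ^ q     ≈⟨ *-cong e^q≈e z^q≈gz ⟩
        e * (g * z)       ≈⟨ x∙yz≈y∙xz e g z ⟩
        g * (e * z)       ∎)
        where
        P = p ℕ.^ d
        open FrobeniusEigen eigen-d renaming (eigenvalue to e; eigenvalue-fixed to e^q≈e; eigen-eq to z^P≈ez)
        ez≉0 : ¬ e * z ≈ 0#
        ez≉0 ez≈0 = ^-≉0 P z≉0 (trans z^P≈ez ez≈0)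

      z^qʲ≈gʲz : ∀ j → z ^ (q ℕ.^ j) ≈ g ^ j * z
      z^qʲ≈gʲz zero    = trans (*-identityʳ z) (sym (*-identityˡ z))
      z^qʲ≈gʲz (suc j) = begin
        z ^ (q ℕ.* q ℕ.^ j)            ≈⟨ ^-assocʳ z q (q ℕ.^ j) ⟨
        (z ^ q) ^ (q ℕ.^ j)            ≈⟨ ^-congˡ (q ℕ.^ j) z^q≈gz ⟩
        (g * z) ^ (q ℕ.^ j)            ≈⟨ ^-distrib-* g z (q ℕ.^ j) ⟩
        g ^ (q ℕ.^ j) * z ^ (q ℕ.^ j)  ≈⟨ *-cong (fixed⇒fixedⁱ g^q≈g j) (z^qʲ≈gʲz j) ⟩
        g * (g ^ j * z)                ≈⟨ *-assoc g (g ^ j) z ⟨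
        g * g ^ j * z                  ∎

      gⁿ≈1 : g ^ n ≈ 1#
      gⁿ≈1 = *-cancelʳ z≉0 (begin
        g ^ n * z               ≈⟨ z^qʲ≈gʲz n ⟨
        z ^ (q ℕ.^ n)           ≈⟨ ^-congʳ z (≡.trans (ℕ.^-*-assoc p m n) (≡.cong (p ℕ.^_) (ℕ.*-comm m n))) ⟩
        z ^ (p ℕ.^ (n ℕ.* m))   ≈⟨ periodic z ⟩
        z                       ≈⟨ *-identityˡ z ⟨
        1# * z                  ∎)

      g^[p^d∸1]≈1 : g ^ (p ℕ.^ d ℕ.∸ 1) ≈ 1#
      g^[p^d∸1]≈1 = *-cancelˡ g≉0 (begin
        g * g ^ (p ℕ.^ d ℕ.∸ 1)  ≈⟨ ^-congʳ g (ℕ.m+[n∸m]≡n (ℕ.m^n>0 p {{prime⇒nonZero p-prime}} d)) ⟩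
        g ^ (p ℕ.^ d)            ≈⟨ g^[p^d]≈g ⟩
        g                        ≈⟨ *-identityʳ g ⟨
        g * 1#                   ∎)

      z-fixed : z ^ q ≈ z
      z-fixed = trans z^q≈gz (trans (*-congʳ g≈1) (*-identityˡ z))
        where
        g≈1 : g ≈ 1#
        g≈1 = trans (sym (*-identityʳ g))
                    (≡.subst (λ k → g ^ k ≈ 1#) coprime (^≈1-gcd g n _ gⁿ≈1 g^[p^d∸1]≈1))

      trace-≉0 : ¬ trace q n z ≈ 0#
      trace-≉0 trace≈0 = 1≉0 (trans (sym (×-homo-1 1#))
        (≡.subst (λ k → k · 1# ≈ 0#) (prime∤⇒gcd≡1 p-prime p∤n) (·1≈0-gcd p n char n·1≈0)))
        where
        n·1≈0 : n · 1# ≈ 0#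
        n·1≈0 = *-cancelʳ z≉0 (begin
          (n · 1#) * z     ≈⟨ ·≈·1* n z ⟨
          n · z            ≈⟨ trace-fixed z-fixed n ⟨
          trace q n z      ≈⟨ trace≈0 ⟩
          0#               ≈⟨ zeroˡ z ⟨
          0# * z           ∎)

    kernel-trivial : ∀ z → trace q n z ≈ 0# → L p r c z ≈ 0# → z ≈ 0#
    kernel-trivial z trace≈0 Lz≈0 = decidable-stable (z ≟ 0#)
      (λ z≉0 → trace-≉0 z≉0 (eigen c c^q≈c (x∙y⁻¹≈ε⇒x≈y _ _ Lz≈0)) trace≈0)

    L-preserves-kernel : ∀ x → InKer q n x → InKer q n (L p r c x)
    L-preserves-kernel x trace≈0 =
      trans (trace-L {r} c^q≈c n x) (trans (L-cong r c trace≈0) (LHom.0#-homo r c))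

    L-injective-on-kernel : ∀ x y → InKer q n x → InKer q n y → L p r c x ≈ L p r c y → x ≈ y
    L-injective-on-kernel x y trace-x≈0 trace-y≈0 Lx≈Ly = x∙y⁻¹≈ε⇒x≈y x y (kernel-trivial (x - y)
      (trans (TraceHom.sub-homo n x y) (x≈y⇒x∙y⁻¹≈ε (trans trace-x≈0 (sym trace-y≈0))))
      (trans (LHom.sub-homo r c x y) (x≈y⇒x∙y⁻¹≈ε Lx≈Ly)))

    L-permutes-kernel : PermutesOn (InKer q n) (L p r c)
    L-permutes-kernel = L-preserves-kernel , L-injective-on-kernel ,
      injective⇒surjective (λ x → trace q n x ≟ 0#) (λ x≈y → trans (sym (trace-cong n x≈y)))
                           L-preserves-kernel L-injective-on-kernel

open import Data.Nat using (_*_; _^_; _∸_; _≥_; NonZero; pred; >-nonZero)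
open import Data.Nat.Properties using (m^n≢0; m*n≢0; suc-pred; ^-*-assoc; *-comm)

corollary2p9 : (p m n r : ℕ) → Prime p → m ≥ 1 → n ≥ 1 → r ≥ 1 →
    gcd (n * m) r ≡ gcd m r → ¬ (p ∣ n) → gcd n (p ^ gcd m r ∸ 1) ≡ 1 →
    (F : CommutativeRing 0ℓ 0ℓ) → FF.IsField F → FF.HasCard F ((p ^ m) ^ n) →
    (c : CommutativeRing.Carrier F) →
    CommutativeRing._≈_ F (FF._^_ F c (p ^ m)) c →
    FF.PermutesOn F (FF.InKer F (p ^ m) n) (FF.L F p r c)
corollary2p9 p m n r p-prime m≥1 n≥1 _ gcd-eq p∤n coprime F isField card c c^q≈c = L-permutes-kernel
  where
  card≢0 : NonZero ((p ^ m) ^ n)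
  card≢0 = m^n≢0 (p ^ m) n {{m^n≢0 p m {{prime⇒nonZero p-prime}}}}

  card≡pⁿᵐ : suc (pred ((p ^ m) ^ n)) ≡ p ^ (n * m)
  card≡pⁿᵐ = ≡.trans (suc-pred _ {{card≢0}}) (≡.trans (^-*-assoc p m n) (≡.cong (p ^_) (*-comm m n)))

  open FiniteFieldTheory.TraceKernel F isField (≡.subst (FF.HasCard F) (≡.sym (suc-pred _ {{card≢0}})) card) p-prime
    {{m*n≢0 n m {{>-nonZero n≥1}} {{>-nonZero m≥1}}}} card≡pⁿᵐ gcd-eq p∤n coprime c^q≈c
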